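{- For every PLTL formula $W$, the number $N$ of new proposition symbols introduced by the translation $\tau_0[W]$ into SNF satisfies $N\le 1+4\cdot\mathrm{len}(W)$.
   Context: PLTL formulae are built from proposition symbols, $\mathbf{true}$, $\mathbf{false}$, $\neg,\vee,\wedge,\Rightarrow$ and temporal operators $\bigcirc$ (next), $\Diamond$ (sometime), $\Box$ (always), $\mathcal{U}$ (until), $\mathcal{W}$ (unless); $\mathbf{start}$ is a nullary connective true only at the first moment. A literal is a proposition symbol or its negation. A PLTL-clause is a formula $\mathbf{start}\Rightarrow\bigvee_c l_c$, $\bigwedge_a k_a\Rightarrow\bigcirc\bigvee_d l_d$ or $\bigwedge_b k_b\Rightarrow\Diamond l$ with all $k,l$ literals. The translation: $\tau_0[A]=\Box(\mathbf{start}\Rightarrow y)\wedge\tau_1[\Box(y\Rightarrow A)]$ with $y$ a fresh proposition symbol, where $\tau_1$, applied to $\Box(x\Rightarrow W)$ ($x$ a proposition symbol), is computed by applying the following rewrite rules repeatedly until the result is a conjunction of formulae $\Box A_i$, each $A_i$ a PLTL-clause (write $\tau_1[x\Rightarrow A]$ for $\tau_1[\Box(x\Rightarrow A)]$; $y,z,v$ are proposition symbols new at each application; $l,m,l_i$ literals; $\neg\mathbf{true}$, $\neg\mathbf{false}$ rewritten to $\mathbf{false}$, $\mathbf{true}$). (1) $x\Rightarrow(A\wedge B)\mapsto\tau_1[x\Rightarrow A]\wedge\tau_1[x\Rightarrow B]$; $x\Rightarrow(A\Rightarrow B)\mapsto\tau_1[x\Rightarrow\neg A\vee B]$; $x\Rightarrow\neg(A\wedge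 B)\mapsto\tau_1[x\Rightarrow\neg A\vee\neg B]$; $x\Rightarrow\neg(A\Rightarrow B)\mapsto\tau_1[x\Rightarrow A]\wedge\tau_1[x\Rightarrow\neg B]$; $x\Rightarrow\neg(A\vee B)\mapsto\tau_1[x\Rightarrow\neg A]\wedge\tau_1[x\Rightarrow\neg B]$. (2) $x\Rightarrow\bigcirc A\mapsto\Box(x\Rightarrow\bigcirc y)\wedge\tau_1[y\Rightarrow A]$ if $A$ is neither a literal nor a disjunction of literals; $x\Rightarrow\neg\bigcirc A\mapsto\Box(x\Rightarrow\bigcirc y)\wedge\tau_1[y\Rightarrow\neg A]$; $x\Rightarrow\Box A\mapsto\tau_1[x\Rightarrow\Box y]\wedge\tau_1[y\Rightarrow A]$ ($A$ not a literal); $x\Rightarrow\neg\Box A\mapsto\Box(x\Rightarrow\Diamond y)\wedge\tau_1[y\Rightarrow\neg A]$; $x\Rightarrow\Diamond A\mapsto\Box(x\Rightarrow\Diamond y)\wedge\tau_1[y\Rightarrow A]$ ($A$ not a literal); $x\Rightarrow\neg\Diamond A\mapsto\tau_1[x\Rightarrow\Box y]\wedge\tau_1[y\Rightarrow\neg A]$; $x\Rightarrow A\,\mathcal{U}\,B\mapsto\tau_1[x\Rightarrow y\,\mathcal{U}\,B]\wedge\tau_1[y\Rightarrow A]$ ($A$ not a literal), $\mapsto\tau_1[x\Rightarrow A\,\mathcal{U}\,y]\wedge\tau_1[y\Rightarrow B]$ ($B$ not a literal); the same with $\mathcal{W}$ for $\mathcal{U}$; $x\Rightarrow\neg(A\,\mathcal{U}\,B)\mapsto\tau_1[x\Rightarrow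 y\,\mathcal{W}\,v]\wedge\tau_1[y\Rightarrow\neg B]\wedge\tau_1[v\Rightarrow(y\wedge z)]\wedge\tau_1[z\Rightarrow\neg A]$; $x\Rightarrow\neg(A\,\mathcal{W}\,B)\mapsto\tau_1[x\Rightarrow y\,\mathcal{U}\,v]\wedge\tau_1[y\Rightarrow\neg B]\wedge\tau_1[v\Rightarrow(y\wedge z)]\wedge\tau_1[z\Rightarrow\neg A]$. (3) $x\Rightarrow\Box l\mapsto\tau_1[x\Rightarrow l]\wedge\tau_1[x\Rightarrow y]\wedge\Box(y\Rightarrow\bigcirc l)\wedge\Box(y\Rightarrow\bigcirc y)$; $x\Rightarrow l\,\mathcal{U}\,m\mapsto\Box(x\Rightarrow\Diamond m)\wedge\tau_1[x\Rightarrow l\vee m]\wedge\tau_1[x\Rightarrow y\vee m]\wedge\Box(y\Rightarrow\bigcirc(l\vee m))\wedge\Box(y\Rightarrow\bigcirc(y\vee m))$; $x\Rightarrow l\,\mathcal{W}\,m\mapsto$ the same without $\Box(x\Rightarrow\Diamond m)$. (4) $x\Rightarrow D\vee A\mapsto\tau_1[x\Rightarrow D\vee y]\wedge\tau_1[y\Rightarrow A]$, $D$ a disjunction, $A$ neither a literal nor a disjunction of literals. (5) $x\Rightarrow D\mapsto\Box(\mathbf{start}\Rightarrow\neg x\vee D)\wedge\Box(\mathbf{true}\Rightarrow\bigcirc(\neg x\vee D))$ for $D$ a literal or disjunction of literals; $x\Rightarrow\mathbf{true}\mapsto\Box(\mathbf{start}\Rightarrow\mathbf{true})\wedge\Box(\mathbf{true}\Rightarrow\bigcirc\mathbf{true})$;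 $x\Rightarrow\mathbf{false}\mapsto\Box(\mathbf{start}\Rightarrow\neg x)\wedge\Box(\mathbf{true}\Rightarrow\bigcirc\neg x)$; $\tau_1[x\Rightarrow\Diamond l]=\Box(x\Rightarrow\Diamond l)$; $\tau_1[x\Rightarrow\bigcirc(l_1\vee\dots\vee l_n)]=\Box(x\Rightarrow\bigcirc(l_1\vee\dots\vee l_n))$. Length: $\mathrm{len}(\Diamond l)=1$; $\mathrm{len}(l_1\vee\dots\vee l_n)=1$ ($n\ge1$); $\mathrm{len}(c)=1$ for $c\in\{\mathbf{true},\neg\mathbf{true},\mathbf{false},\neg\mathbf{false}\}$; $\mathrm{len}(\bigcirc(l_1\vee\dots\vee l_n))=1$; $\mathrm{len}(\neg\Box A)=\mathrm{len}(\neg\Diamond A)=\mathrm{len}(\neg\bigcirc A)=1+\mathrm{len}(\neg A)$; $\mathrm{len}(\Box A)=1+\mathrm{len}(A)$; $\mathrm{len}(\Diamond A)=1+\mathrm{len}(A)$ ($A$ not a literal); $\mathrm{len}(\bigcirc A)=1+\mathrm{len}(A)$ ($A$ not a disjunction of literals); for $\circ\in\{\mathcal{U},\mathcal{W},\vee,\wedge\}$: $\mathrm{len}(\neg(A\circ B))=1+\mathrm{len}(\neg A)+\mathrm{len}(\neg B)$ and $\mathrm{len}(A\circ B)=1+\mathrm{len}(A)+\mathrm{len}(B)$ (for $\vee$: $A,B$ not disjunctions of literals); $\mathrm{len}(\neg(A\Rightarrow B))=1+\mathrm{len}(A)+\mathrm{len}(\neg B)$; $\mathrm{len}(A\Rightarrow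 B)=1+\mathrm{len}(\neg A)+\mathrm{len}(B)$. -}

module Defs where

open import Data.Nat using (ℕ; suc; _+_; _*_; _≤_)
open import Relation.Nullary using (¬_)

-- The nullary connective start only occurs in the produced SNF clauses,
-- not in input formulae, so it is not part of this syntax.

infixr 5 ~_ ○_ ◇_ □_
infixr 4 _∧_
infixr 3 _∨_
infixr 2 _⇒_
infixr 6 _𝒰_ _𝒲_

data Fm : Set where
  var        : ℕ → Fm
  true false : Fm
  ~_         : Fm → Fm
  _∨_        : Fm → Fm → Fm
  _∧_        : Fm → Fm → Fm
  _⇒_        : Fm → Fm → Fm
  ○_         : Fm → Fm
  ◇_         : Fm → Fm
  □_         : Fm → Fm
  _𝒰_        : Fm → Fm → Fm
  _𝒲_        : Fm → Fm → Fm

data IsLit : Fm → Set where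
  pos : ∀ p → IsLit (var p)
  neg : ∀ p → IsLit (~ var p)

data DisjLit : Fm → Set where
  lit : ∀ {l} → IsLit l → DisjLit l
  or  : ∀ {A B} → DisjLit A → DisjLit B → DisjLit (A ∨ B)

-- Proper positions in a disjunction: a context C[·] whose path from the
-- root to the hole passes only through ∨ and has length ≥ 1.  Thus
-- plug K A is "D ∨ A" up to associativity/commutativity of ∨.

data DCtx : Set where
  hereL : Fm → DCtx
  hereR : Fm → DCtx
  inL   : DCtx → Fm → DCtx
  inR   : Fm → DCtx → DCtx

plug : DCtx → Fm → Fm
plug (hereL B) A = A ∨ B
plug (hereR B) A = B ∨ A
plug (inL K B) A = plug K A ∨ B
plug (inR B K) A = B ∨ plug K A

-- Tr A n : the rewriting of τ₁[x ⇒ A] (x a proposition symbol) can be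
-- carried to completion (a conjunction of □-PLTL-clauses) introducing
-- exactly n new proposition symbols.  One constructor per rewrite rule;
-- the fresh symbols are given explicitly (y, z, v : ℕ).  Clauses that
-- are produced directly (e.g. □(x ⇒ ○ y)) contribute nothing further;
-- recursive τ₁ calls are recursive premises.  The rules only inspect
-- literal/disjunction shape, so the count does not depend on the names.

data Tr : Fm → ℕ → Set where
  r-and  : ∀ {A B n m} → Tr A n → Tr B m → Tr (A ∧ B) (n + m)
  r-imp  : ∀ {A B n} → Tr (~ A ∨ B) n → Tr (A ⇒ B) n
  r-nand : ∀ {A B n} → Tr (~ A ∨ ~ B) n → Tr (~ (A ∧ B)) n
  r-nimp : ∀ {A B n m} → Tr A n → Tr (~ B) m → Tr (~ (A ⇒ B)) (n + m)
  r-nor  : ∀ {A B n m} → Tr (~ A) n → Tr (~ B) m → Tr (~ (A ∨ B)) (n + m)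
  r-next : ∀ {A n} → ¬ DisjLit A → (y : ℕ) → Tr A n → Tr (○ A) (suc n)
  r-nnext : ∀ {A n} → (y : ℕ) → Tr (~ A) n → Tr (~ ○ A) (suc n)
  r-box  : ∀ {A n m} → ¬ IsLit A → (y : ℕ) →
           Tr (□ var y) n → Tr A m → Tr (□ A) (suc (n + m))
  r-nbox : ∀ {A n} → (y : ℕ) → Tr (~ A) n → Tr (~ □ A) (suc n)
  r-dia  : ∀ {A n} → ¬ IsLit A → (y : ℕ) → Tr A n → Tr (◇ A) (suc n)
  r-ndia : ∀ {A n m} → (y : ℕ) →
           Tr (□ var y) n → Tr (~ A) m → Tr (~ ◇ A) (suc (n + m))
  r-untilL : ∀ {A B n m} → ¬ IsLit A → (y : ℕ) →
             Tr (var y 𝒰 B) n → Tr A m → Tr (A 𝒰 B) (suc (n + m))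
  r-untilR : ∀ {A B n m} → ¬ IsLit B → (y : ℕ) →
             Tr (A 𝒰 var y) n → Tr B m → Tr (A 𝒰 B) (suc (n + m))
  r-unlessL : ∀ {A B n m} → ¬ IsLit A → (y : ℕ) →
              Tr (var y 𝒲 B) n → Tr A m → Tr (A 𝒲 B) (suc (n + m))
  r-unlessR : ∀ {A B n m} → ¬ IsLit B → (y : ℕ) →
              Tr (A 𝒲 var y) n → Tr B m → Tr (A 𝒲 B) (suc (n + m))
  r-nuntil : ∀ {A B n₁ n₂ n₃ n₄} → (y z v : ℕ) →
             Tr (var y 𝒲 var v) n₁ → Tr (~ B) n₂ →
             Tr (var y ∧ var z) n₃ → Tr (~ A) n₄ →
             Tr (~ (A 𝒰 B)) (3 + (n₁ + n₂ + n₃ + n₄))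
  r-nunless : ∀ {A B n₁ n₂ n₃ n₄} → (y z v : ℕ) →
              Tr (var y 𝒰 var v) n₁ → Tr (~ B) n₂ →
              Tr (var y ∧ var z) n₃ → Tr (~ A) n₄ →
              Tr (~ (A 𝒲 B)) (3 + (n₁ + n₂ + n₃ + n₄))
  r-boxLit : ∀ {l n m} → IsLit l → (y : ℕ) →
             Tr l n → Tr (var y) m → Tr (□ l) (suc (n + m))
  r-untilLit : ∀ {l k n m} → IsLit l → IsLit k → (y : ℕ) →
               Tr (l ∨ k) n → Tr (var y ∨ k) m → Tr (l 𝒰 k) (suc (n + m))
  r-unlessLit : ∀ {l k n m} → IsLit l → IsLit k → (y : ℕ) →
                Tr (l ∨ k) n → Tr (var y ∨ k) m → Tr (l 𝒲 k) (suc (n + m))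
  r-disj : ∀ {A n m} → (K : DCtx) → ¬ DisjLit A → (y : ℕ) →
           Tr (plug K (var y)) n → Tr A m → Tr (plug K A) (suc (n + m))
  r-clause : ∀ {D} → DisjLit D → Tr D 0
  r-true   : Tr true 0
  r-false  : Tr false 0
  r-ntrue  : Tr (~ true) 0     -- ¬true is rewritten to false
  r-nfalse : Tr (~ false) 0    -- ¬false is rewritten to true
  r-diaLit : ∀ {l} → IsLit l → Tr (◇ l) 0
  r-nextLit : ∀ {D} → DisjLit D → Tr (○ D) 0

-- τ₀[W] = □(start ⇒ y) ∧ τ₁[□(y ⇒ W)] with y fresh:
-- Tau0 W N : the translation τ₀[W] introduces N new proposition symbols.
data Tau0 : Fm → ℕ → Set where
  tau0 : ∀ {V n} → (y : ℕ) → Tr V n → Tau0 V (suc n)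

-- Len A k : len(A) = k  (len is defined by the paper's clauses; it is a
-- partial function, undefined exactly on formulae containing a ¬~ that
-- the clauses do not cover, hence a relation).

data Len : Fm → ℕ → Set where
  l-diaLit : ∀ {l} → IsLit l → Len (◇ l) 1
  l-disj   : ∀ {D} → DisjLit D → Len D 1
  l-true   : Len true 1
  l-ntrue  : Len (~ true) 1
  l-false  : Len false 1
  l-nfalse : Len (~ false) 1
  l-nextLit : ∀ {D} → DisjLit D → Len (○ D) 1
  l-nbox  : ∀ {A a} → Len (~ A) a → Len (~ □ A) (suc a)
  l-ndia  : ∀ {A a} → Len (~ A) a → Len (~ ◇ A) (suc a)
  l-nnext : ∀ {A a} → Len (~ A) a → Len (~ ○ A) (suc a)
  l-box   : ∀ {A a} → Len A a → Len (□ A) (suc a)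
  l-dia   : ∀ {A a} → ¬ IsLit A → Len A a → Len (◇ A) (suc a)
  l-next  : ∀ {A a} → ¬ DisjLit A → Len A a → Len (○ A) (suc a)
  l-nuntil  : ∀ {A B a b} → Len (~ A) a → Len (~ B) b → Len (~ (A 𝒰 B)) (suc (a + b))
  l-nunless : ∀ {A B a b} → Len (~ A) a → Len (~ B) b → Len (~ (A 𝒲 B)) (suc (a + b))
  l-nor     : ∀ {A B a b} → Len (~ A) a → Len (~ B) b → Len (~ (A ∨ B)) (suc (a + b))
  l-nand    : ∀ {A B a b} → Len (~ A) a → Len (~ B) b → Len (~ (A ∧ B)) (suc (a + b))
  l-until   : ∀ {A B a b} → Len A a → Len B b → Len (A 𝒰 B) (suc (a + b))
  l-unless  : ∀ {A B a b} → Len A a → Len B b → Len (A 𝒲 B) (suc (a + b))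
  l-or      : ∀ {A B a b} → ¬ DisjLit (A ∨ B) → Len A a → Len B b → Len (A ∨ B) (suc (a + b))
  l-and     : ∀ {A B a b} → Len A a → Len B b → Len (A ∧ B) (suc (a + b))
  l-nimp    : ∀ {A B a b} → Len A a → Len (~ B) b → Len (~ (A ⇒ B)) (suc (a + b))
  l-imp     : ∀ {A B a b} → Len (~ A) a → Len B b → Len (A ⇒ B) (suc (a + b))

{-# OPTIONS --safe #-}
-- Define by structural recursion a bound cost A (and negCost A) on the number of fresh
-- symbols that rewriting τ₁[x ⇒ A] (resp. τ₁[x ⇒ ¬A]) can introduce, whatever the order
-- in which the rules are applied: a subformula in operand position of □, 𝒰, 𝒲 (resp. in
-- disjunct position) costs one extra symbol for its renaming unless it is a literal (resp.
-- a disjunction of literals).  Every rule respects the bound.  Comparing the recursion for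
-- cost with that for len, each unit of length pays for at most four symbols and a leaf
-- costs at most one, so cost A ≤ 4 · len A − 3; τ₀ adds one more symbol.
module Submission where

open import Defs
open import Data.Nat using (ℕ; _+_; _*_; _≤_; suc; z≤n; s≤s)
open import Data.Nat.Properties
open import Data.Bool using (Bool; true; false; if_then_else_) renaming (_∧_ to _and_)
open import Data.Bool.Properties using (¬-not; ∧-conicalˡ; ∧-conicalʳ)
open import Function using (_∘_)
open import Relation.Binary.PropositionalEquality
open import Relation.Nullary using (¬_)
open import Algebra.Properties.CommutativeSemigroup +-commutativeSemigroup using (xy∙z≈xz∙y)

isLiteral : Fm → Bool
isLiteral (var _)   = true
isLiteral (~ var _) = true
isLiteral _         = false

isDisjLit : Fm → Bool
isDisjLit (A ∨ B) = isDisjLit A and isDisjLit B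
isDisjLit A       = isLiteral A

isLiteral-sound : ∀ A → isLiteral A ≡ true → IsLit A
isLiteral-sound (var p)   _ = pos p
isLiteral-sound (~ var p) _ = neg p

isDisjLit-sound : ∀ A → isDisjLit A ≡ true → DisjLit A
isDisjLit-sound (var p)   _ = lit (pos p)
isDisjLit-sound (~ var p) _ = lit (neg p)
isDisjLit-sound (A ∨ B)   e =
  or (isDisjLit-sound A (∧-conicalˡ _ _ e)) (isDisjLit-sound B (∧-conicalʳ _ _ e))

isDisjLit-complete : ∀ {A} → DisjLit A → isDisjLit A ≡ true
isDisjLit-complete (lit (pos p)) = refl
isDisjLit-complete (lit (neg p)) = refl
isDisjLit-complete (or d e)      = cong₂ _and_ (isDisjLit-complete d) (isDisjLit-complete e)

¬IsLit⇒isLiteral≡false : ∀ {A} → ¬ IsLit A → isLiteral A ≡ false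
¬IsLit⇒isLiteral≡false {A} ¬l = ¬-not (¬l ∘ isLiteral-sound A)

¬DisjLit⇒isDisjLit≡false : ∀ {A} → ¬ DisjLit A → isDisjLit A ≡ false
¬DisjLit⇒isDisjLit≡false {A} ¬d = ¬-not (¬d ∘ isDisjLit-sound A)

mutual
  cost : Fm → ℕ
  cost (var _)  = 0
  cost true     = 0
  cost false    = 0
  cost (~ A)    = negCost A
  cost (A ∨ B)  = disjunctCost A + disjunctCost B
  cost (A ∧ B)  = cost A + cost B
  cost (A ⇒ B)  = suc (negCost A) + suc (cost B)
  cost (○ A)    = suc (cost A)
  cost (◇ A)    = suc (cost A)
  cost (□ A)    = suc (operandCost A)
  cost (A 𝒰 B) = untilCost A B
  cost (A 𝒲 B) = untilCost A B

  negCost : Fm → ℕ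
  negCost (var _)  = 0
  negCost true     = 0
  negCost false    = 0
  -- No rule applies to a double negation.
  negCost (~ _)    = 0
  negCost (A ∨ B)  = negCost A + negCost B
  negCost (A ∧ B)  = suc (negCost A) + suc (negCost B)
  negCost (A ⇒ B)  = cost A + negCost B
  negCost (○ A)    = suc (negCost A)
  negCost (◇ A)    = 2 + negCost A
  negCost (□ A)    = suc (negCost A)
  negCost (A 𝒰 B) = 4 + (negCost A + negCost B)
  negCost (A 𝒲 B) = 4 + (negCost A + negCost B)

  disjunctCost : Fm → ℕ
  disjunctCost A = if isDisjLit A then 0 else suc (cost A)

  operandCost : Fm → ℕ
  operandCost A = if isLiteral A then 0 else suc (cost A)

  untilCost : Fm → Fm → ℕ
  untilCost A B = suc (operandCost A + operandCost B)

disjunctCost≤ : ∀ A → disjunctCost A ≤ suc (cost A)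
disjunctCost≤ A with isDisjLit A
... | true  = z≤n
... | false = ≤-refl

operandCost≤ : ∀ A → operandCost A ≤ suc (cost A)
operandCost≤ A with isLiteral A
... | true  = z≤n
... | false = ≤-refl

disjunctCost-DisjLit : ∀ {A} → DisjLit A → disjunctCost A ≡ 0
disjunctCost-DisjLit {A} d = cong (if_then 0 else suc (cost A)) (isDisjLit-complete d)

disjunctCost-¬DisjLit : ∀ {A} → ¬ DisjLit A → disjunctCost A ≡ suc (cost A)
disjunctCost-¬DisjLit {A} ¬d = cong (if_then 0 else suc (cost A)) (¬DisjLit⇒isDisjLit≡false ¬d)

operandCost-¬IsLit : ∀ {A} → ¬ IsLit A → operandCost A ≡ suc (cost A)
operandCost-¬IsLit {A} ¬l = cong (if_then 0 else suc (cost A)) (¬IsLit⇒isLiteral≡false ¬l)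

cost-DisjLit : ∀ {D} → DisjLit D → cost D ≡ 0
cost-DisjLit (lit (pos p)) = refl
cost-DisjLit (lit (neg p)) = refl
cost-DisjLit (or d e)      = cong₂ _+_ (disjunctCost-DisjLit d) (disjunctCost-DisjLit e)

plug-¬DisjLit : ∀ K {A} → ¬ DisjLit A → ¬ DisjLit (plug K A)
plug-¬DisjLit (hereL _) ¬d (or d _) = ¬d d
plug-¬DisjLit (hereR _) ¬d (or _ d) = ¬d d
plug-¬DisjLit (inL K _) ¬d (or d _) = plug-¬DisjLit K ¬d d
plug-¬DisjLit (inR _ K) ¬d (or _ d) = plug-¬DisjLit K ¬d d

mutual
  renamed-disjunct : ∀ K y {A} → ¬ DisjLit A →
                     disjunctCost (plug K (var y)) + suc (cost A) ≤ suc (cost (plug K A))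
  renamed-disjunct K y {A} ¬d =
    ≤-trans (+-monoˡ-≤ (suc (cost A)) (disjunctCost≤ (plug K (var y))))
            (s≤s (cost-plug-rename K y ¬d))

  -- Only ≤: after the renaming, ∨-nodes above the hole may have become clauses.
  cost-plug-rename : ∀ K y {A} → ¬ DisjLit A →
                     cost (plug K (var y)) + suc (cost A) ≤ cost (plug K A)
  cost-plug-rename (hereL B) y {A} ¬d rewrite disjunctCost-¬DisjLit ¬d =
    ≤-reflexive (+-comm (disjunctCost B) (suc (cost A)))
  cost-plug-rename (hereR B) y {A} ¬d rewrite disjunctCost-¬DisjLit ¬d =
    ≤-reflexive (cong (_+ suc (cost A)) (+-identityʳ (disjunctCost B)))
  cost-plug-rename (inL K B) y {A} ¬d rewrite disjunctCost-¬DisjLit (plug-¬DisjLit K ¬d) = begin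
    disjunctCost (plug K (var y)) + disjunctCost B + suc (cost A)
      ≡⟨ xy∙z≈xz∙y (disjunctCost (plug K (var y))) (disjunctCost B) (suc (cost A)) ⟩
    disjunctCost (plug K (var y)) + suc (cost A) + disjunctCost B
      ≤⟨ +-monoˡ-≤ (disjunctCost B) (renamed-disjunct K y ¬d) ⟩
    suc (cost (plug K A)) + disjunctCost B ∎
    where open ≤-Reasoning
  cost-plug-rename (inR B K) y {A} ¬d rewrite disjunctCost-¬DisjLit (plug-¬DisjLit K ¬d) = begin
    disjunctCost B + disjunctCost (plug K (var y)) + suc (cost A)
      ≡⟨ +-assoc (disjunctCost B) (disjunctCost (plug K (var y))) (suc (cost A)) ⟩
    disjunctCost B + (disjunctCost (plug K (var y)) + suc (cost A))
      ≤⟨ +-monoʳ-≤ (disjunctCost B) (renamed-disjunct K y ¬d) ⟩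
    disjunctCost B + suc (cost (plug K A)) ∎
    where open ≤-Reasoning

untilCost-renameˡ : ∀ y {A B} → ¬ IsLit A → untilCost (var y) B + suc (cost A) ≡ untilCost A B
untilCost-renameˡ y {A} {B} ¬l rewrite operandCost-¬IsLit ¬l =
  cong suc (+-comm (operandCost B) (suc (cost A)))

untilCost-renameʳ : ∀ y {A B} → ¬ IsLit B → untilCost A (var y) + suc (cost B) ≡ untilCost A B
untilCost-renameʳ y {A} {B} ¬l rewrite operandCost-¬IsLit ¬l =
  cong (λ a → suc (a + suc (cost B))) (+-identityʳ (operandCost A))

-- The common shape of rules (2)-(4): one fresh symbol y, τ₁ applied to C[y] and to y ⇒ A.
renaming-≤ : ∀ {n m c a} → n ≤ c → m ≤ a → suc (n + m) ≤ c + suc a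
renaming-≤ {c = c} {a} n≤c m≤a = ≤-trans (s≤s (+-mono-≤ n≤c m≤a)) (≤-reflexive (sym (+-suc c a)))

negUntil-≤ : ∀ {n₁ n₂ n₃ n₄ a b} → n₁ ≤ 1 → n₂ ≤ b → n₃ ≤ 0 → n₄ ≤ a →
             3 + (n₁ + n₂ + n₃ + n₄) ≤ 4 + (a + b)
negUntil-≤ {a = a} {b} p q r s =
  ≤-trans (+-monoʳ-≤ 3 (+-mono-≤ (+-mono-≤ (+-mono-≤ p q) r) s))
          (≤-reflexive (cong (4 +_) (trans (cong (_+ a) (+-identityʳ b)) (+-comm b a))))

mutual
  count≤cost : ∀ {A n} → Tr A n → n ≤ cost A
  count≤cost (r-and t u)        = +-mono-≤ (count≤cost t) (count≤cost u)
  count≤cost (r-imp {A} {B} t)  =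
    ≤-trans (count≤cost t) (+-mono-≤ (disjunctCost≤ (~ A)) (disjunctCost≤ B))
  count≤cost (r-nand {A} {B} t) =
    ≤-trans (count≤cost t) (+-mono-≤ (disjunctCost≤ (~ A)) (disjunctCost≤ (~ B)))
  count≤cost (r-nimp t u)       = +-mono-≤ (count≤cost t) (count≤cost u)
  count≤cost (r-nor t u)        = +-mono-≤ (count≤cost t) (count≤cost u)
  count≤cost (r-next _ _ t)     = s≤s (count≤cost t)
  count≤cost (r-nnext _ t)      = s≤s (count≤cost t)
  count≤cost (r-box ¬l _ t u) rewrite operandCost-¬IsLit ¬l =
    renaming-≤ (count≤cost t) (count≤cost u)
  count≤cost (r-nbox _ t)       = s≤s (count≤cost t)
  count≤cost (r-dia _ _ t)      = s≤s (count≤cost t)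
  count≤cost (r-ndia _ t u)     = renaming-≤ (count≤cost t) (count≤cost u)
  count≤cost (r-untilL ¬l y t u) =
    ≤-trans (renaming-≤ (count≤cost t) (count≤cost u)) (≤-reflexive (untilCost-renameˡ y ¬l))
  count≤cost (r-untilR ¬l y t u) =
    ≤-trans (renaming-≤ (count≤cost t) (count≤cost u)) (≤-reflexive (untilCost-renameʳ y ¬l))
  count≤cost (r-unlessL ¬l y t u) =
    ≤-trans (renaming-≤ (count≤cost t) (count≤cost u)) (≤-reflexive (untilCost-renameˡ y ¬l))
  count≤cost (r-unlessR ¬l y t u) =
    ≤-trans (renaming-≤ (count≤cost t) (count≤cost u)) (≤-reflexive (untilCost-renameʳ y ¬l))
  count≤cost (r-nuntil _ _ _ t₁ t₂ t₃ t₄) =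
    negUntil-≤ (count≤cost t₁) (count≤cost t₂) (count≤cost t₃) (count≤cost t₄)
  count≤cost (r-nunless _ _ _ t₁ t₂ t₃ t₄) =
    negUntil-≤ (count≤cost t₁) (count≤cost t₂) (count≤cost t₃) (count≤cost t₄)
  count≤cost (r-boxLit l y t u) =
    s≤s (≤-trans (+-mono-≤ (clause-count≤0 (lit l) t) (clause-count≤0 (lit (pos y)) u)) z≤n)
  count≤cost (r-untilLit l k y t u) =
    s≤s (≤-trans (+-mono-≤ (clause-count≤0 (or (lit l) (lit k)) t)
                           (clause-count≤0 (or (lit (pos y)) (lit k)) u)) z≤n)
  count≤cost (r-unlessLit l k y t u) =
    s≤s (≤-trans (+-mono-≤ (clause-count≤0 (or (lit l) (lit k)) t)
                           (clause-count≤0 (or (lit (pos y)) (lit k)) u)) z≤n)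
  count≤cost (r-disj K ¬d y t u) =
    ≤-trans (renaming-≤ (count≤cost t) (count≤cost u)) (cost-plug-rename K y ¬d)
  count≤cost (r-clause _)  = z≤n
  count≤cost r-true        = z≤n
  count≤cost r-false       = z≤n
  count≤cost r-ntrue       = z≤n
  count≤cost r-nfalse      = z≤n
  count≤cost (r-diaLit _)  = z≤n
  count≤cost (r-nextLit _) = z≤n

  clause-count≤0 : ∀ {D n} → DisjLit D → Tr D n → n ≤ 0
  clause-count≤0 d t = subst (_ ≤_) (cost-DisjLit d) (count≤cost t)

len-leaf : ∀ {x} → x ≤ 1 → x + 3 ≤ 4 * 1
len-leaf = +-monoˡ-≤ 3

len-unary : ∀ {x c a} → x ≤ 4 + c → c + 3 ≤ 4 * a → x + 3 ≤ 4 * suc a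
len-unary {x} {c} {a} x≤ c≤ = begin
  x + 3       ≤⟨ +-monoˡ-≤ 3 x≤ ⟩
  4 + c + 3   ≡⟨ +-assoc 4 c 3 ⟩
  4 + (c + 3) ≤⟨ +-monoʳ-≤ 4 c≤ ⟩
  4 + 4 * a   ≡⟨ *-suc 4 a ⟨
  4 * suc a   ∎
  where open ≤-Reasoning

len-binary : ∀ {x c d a b} → x ≤ 4 + (c + d) → c + 3 ≤ 4 * a → d + 3 ≤ 4 * b →
             x + 3 ≤ 4 * suc (a + b)
len-binary {x} {c} {d} {a} {b} x≤ c≤ d≤ = begin
  x + 3                     ≤⟨ +-monoˡ-≤ 3 x≤ ⟩
  4 + (c + d) + 3           ≡⟨ cong (4 +_) (+-assoc c d 3) ⟩
  4 + (c + (d + 3))         ≤⟨ +-monoʳ-≤ 4 (+-monoˡ-≤ (d + 3) (m≤m+n c 3)) ⟩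
  4 + ((c + 3) + (d + 3))   ≤⟨ +-monoʳ-≤ 4 (+-mono-≤ c≤ d≤) ⟩
  4 + (4 * a + 4 * b)       ≡⟨ cong (4 +_) (*-distribˡ-+ 4 a b) ⟨
  4 + 4 * (a + b)           ≡⟨ *-suc 4 (a + b) ⟨
  4 * suc (a + b)           ∎
  where open ≤-Reasoning

+-suc-mono-≤ : ∀ {x y c d} → x ≤ suc c → y ≤ suc d → x + y ≤ 2 + (c + d)
+-suc-mono-≤ {c = c} {d} x≤ y≤ = ≤-trans (+-mono-≤ x≤ y≤) (≤-reflexive (cong suc (+-suc c d)))

mutual
  cost+3≤4*len : ∀ {A k} → Len A k → cost A + 3 ≤ 4 * k
  cost+3≤4*len (l-diaLit l)  = len-leaf (s≤s (≤-reflexive (cost-DisjLit (lit l))))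
  cost+3≤4*len (l-disj d)    = len-leaf (m≤n⇒m≤1+n (≤-reflexive (cost-DisjLit d)))
  cost+3≤4*len l-true        = len-leaf z≤n
  cost+3≤4*len l-ntrue       = len-leaf z≤n
  cost+3≤4*len l-false       = len-leaf z≤n
  cost+3≤4*len l-nfalse      = len-leaf z≤n
  cost+3≤4*len (l-nextLit d) = len-leaf (s≤s (≤-reflexive (cost-DisjLit d)))
  cost+3≤4*len (l-nbox ℓ)    = len-unary (m≤n+m _ 3) (cost+3≤4*len ℓ)
  cost+3≤4*len (l-ndia ℓ)    = len-unary (m≤n+m _ 2) (cost+3≤4*len ℓ)
  cost+3≤4*len (l-nnext ℓ)   = len-unary (m≤n+m _ 3) (cost+3≤4*len ℓ)
  cost+3≤4*len (l-box {A} ℓ) = len-unary (s≤s (m≤n⇒m≤o+n 2 (operandCost≤ A))) (cost+3≤4*len ℓ)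
  cost+3≤4*len (l-dia _ ℓ)   = len-unary (m≤n+m _ 3) (cost+3≤4*len ℓ)
  cost+3≤4*len (l-next _ ℓ)  = len-unary (m≤n+m _ 3) (cost+3≤4*len ℓ)
  cost+3≤4*len (l-nuntil ℓ₁ ℓ₂)  = binary-step ≤-refl ℓ₁ ℓ₂
  cost+3≤4*len (l-nunless ℓ₁ ℓ₂) = binary-step ≤-refl ℓ₁ ℓ₂
  cost+3≤4*len (l-nor ℓ₁ ℓ₂)     = binary-step (m≤n+m _ 4) ℓ₁ ℓ₂
  cost+3≤4*len (l-nand ℓ₁ ℓ₂)    =
    binary-step (m≤n⇒m≤o+n 2 (+-suc-mono-≤ ≤-refl ≤-refl)) ℓ₁ ℓ₂
  cost+3≤4*len (l-until {A} {B} ℓ₁ ℓ₂) =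
    binary-step (m≤n⇒m≤o+n 1 (s≤s (+-suc-mono-≤ (operandCost≤ A) (operandCost≤ B)))) ℓ₁ ℓ₂
  cost+3≤4*len (l-unless {A} {B} ℓ₁ ℓ₂) =
    binary-step (m≤n⇒m≤o+n 1 (s≤s (+-suc-mono-≤ (operandCost≤ A) (operandCost≤ B)))) ℓ₁ ℓ₂
  cost+3≤4*len (l-or {A} {B} _ ℓ₁ ℓ₂) =
    binary-step (m≤n⇒m≤o+n 2 (+-suc-mono-≤ (disjunctCost≤ A) (disjunctCost≤ B))) ℓ₁ ℓ₂
  cost+3≤4*len (l-and ℓ₁ ℓ₂)     = binary-step (m≤n+m _ 4) ℓ₁ ℓ₂
  cost+3≤4*len (l-nimp ℓ₁ ℓ₂)    = binary-step (m≤n+m _ 4) ℓ₁ ℓ₂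
  cost+3≤4*len (l-imp ℓ₁ ℓ₂)     =
    binary-step (m≤n⇒m≤o+n 2 (+-suc-mono-≤ ≤-refl ≤-refl)) ℓ₁ ℓ₂

  binary-step : ∀ {x A B a b} → x ≤ 4 + (cost A + cost B) → Len A a → Len B b →
                x + 3 ≤ 4 * suc (a + b)
  binary-step {a = a} {b} x≤ ℓ₁ ℓ₂ =
    len-binary {a = a} {b = b} x≤ (cost+3≤4*len ℓ₁) (cost+3≤4*len ℓ₂)

theorem7 : (W : Fm) (N k : ℕ) → Tau0 W N → Len W k → N ≤ 1 + 4 * k
theorem7 W .(suc _) k (tau0 _ t) ℓ =
  s≤s (≤-trans (count≤cost t) (m+n≤o⇒m≤o (cost W) (cost+3≤4*len ℓ)))
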